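{- Let $m\ge 1$ and let $M\in\Lambda_{2m}^m$ satisfy $M_{i,1}=1$ and $M_{1,j}=1$ for all $1\le i,j\le m$. Let $R_1=C_1=\{1\}$, $R_2=C_2=\{2,\dots,m\}$, $R_3=C_3=\{m+1,\dots,2m\}$, and let $M_{a,b}$ denote the set of cells $R_a\times C_b$. Then there exists a critical set $K$ of $M$ such that: $(1,1,1)\in K$; $K$ contains no triple whose cell lies in $M_{1,2}\cup M_{1,3}\cup M_{2,1}\cup M_{3,1}$; $K$ contains every triple $(i,j,0)\in M$ with $(i,j)\in M_{2,2}\cup M_{2,3}\cup M_{3,2}$; and $K$ contains no triple $(i,j,1)$ with $(i,j)\in M_{2,2}\cup M_{2,3}\cup M_{3,2}\cup M_{3,3}$.
   Context: $\Lambda_{n}^{x}$ is the set of $n\times n$ $(0,1)$-matrices with every row sum and every column sum equal to $x$. A matrix $M$ is identified with the set of triples $\{(i,j,M_{ij})\}$. A subset $D\subseteq M$ is a defining set for $M$ if $M$ is the unique element of $\Lambda_{2m}^m$ containing $D$; a critical set is a defining set none of whose proper subsets is a defining set. -}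

module Defs where

open import Data.Nat using (ℕ; zero; suc; _+_; _≤_; _<_)
open import Data.Bool using (Bool; true; false)
open import Data.Fin using (Fin; toℕ) renaming (zero to fzero; suc to fsuc)
open import Data.Product using (_×_; Σ; ∃₂)
open import Data.Sum using (_⊎_)
open import Relation.Binary.PropositionalEquality using (_≡_)
open import Relation.Nullary using (¬_)

-- A (0,1)-matrix of size n × n; entry true = 1, false = 0.
-- Indices are 0-based: paper row/column r corresponds to Fin index r - 1.
Matrix : ℕ → Set
Matrix n = Fin n → Fin n → Bool

bit : Bool → ℕ
bit true  = 1
bit false = 0

sumFin : (n : ℕ) → (Fin n → ℕ) → ℕ
sumFin zero    f = 0
sumFin (suc n) f = f fzero + sumFin n (λ i → f (fsuc i))

rowSum : {n : ℕ} → Matrix n → Fin n → ℕ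
rowSum {n} M i = sumFin n (λ j → bit (M i j))

colSum : {n : ℕ} → Matrix n → Fin n → ℕ
colSum {n} M j = sumFin n (λ i → bit (M i j))

InΛ : (n x : ℕ) → Matrix n → Set
InΛ n x M = (∀ i → rowSum M i ≡ x) × (∀ j → colSum M j ≡ x)

-- A subset D of (the triple set of) M is given by the set of cells it uses:
-- D = { (i , j , M i j) | S i j ≡ true }.
CellSet : ℕ → Set
CellSet n = Fin n → Fin n → Bool

-- D ⊆ N  (N contains every triple of D, i.e. agrees with M on the cells of S)
Contains : {n : ℕ} → Matrix n → Matrix n → CellSet n → Set
Contains N M S = ∀ i j → S i j ≡ true → N i j ≡ M i j

IsDefining : (m : ℕ) → Matrix (m + m) → CellSet (m + m) → Set
IsDefining m M S =
  ∀ (N : Matrix (m + m)) → InΛ (m + m) m N → Contains N M S → ∀ i j → N i j ≡ M i j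

ProperSubset : {n : ℕ} → CellSet n → CellSet n → Set
ProperSubset S' S =
  (∀ i j → S' i j ≡ true → S i j ≡ true) × ∃₂ (λ i j → (S i j ≡ true) × (S' i j ≡ false))

IsCritical : (m : ℕ) → Matrix (m + m) → CellSet (m + m) → Set
IsCritical m M S =
  IsDefining m M S × (∀ S' → ProperSubset S' S → ¬ IsDefining m M S')

InR₁ : {n : ℕ} → (m : ℕ) → Fin n → Set
InR₁ m i = toℕ i ≡ 0

InR₂ : {n : ℕ} → (m : ℕ) → Fin n → Set
InR₂ m i = (1 ≤ toℕ i) × (toℕ i < m)

InR₃ : {n : ℕ} → (m : ℕ) → Fin n → Set
InR₃ m i = m ≤ toℕ i

module Submission where

-- Let D₀ consist of the corner cell (1,1) together with
-- every zero of M outside the first row and column.  Then: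
--   * D₀ defines M: in any N ∈ Λ containing D₀ the zeros of M off the first
--     line are zeros of N, so counting ones forces the first column of N,
--     then the remaining rows, and finally the first row.
--   * Being a defining set is a monotone and decidable property of cell sets
--     (decidable by exhausting all matrices), so D₀ contains a critical set K,
--     obtained by greedily discarding cells; K ⊆ D₀ gives the "excluded" parts
--     of the claim at once.
--   * A cell (a,b) lies in every such K as soon as D₀ without (a,b) fails to
--     define M.  For the corner and for the zeros in M₂₂ ∪ M₂₃ ∪ M₃₂ this is
--     witnessed by an intercalate (a 2 × 2 submatrix reading b ¬b / ¬b b)
--     avoiding D₀ ∖ {(a,b)}: switching it yields a second matrix of Λ.
-- Comments use the paper's 1-based indices; in the code row r is Fin index r - 1.

open import Defs
open import Data.Nat using (ℕ; zero; suc; _+_; _≤_; _<_; z≤n; s≤s; _<?_)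
open import Data.Nat.Properties
  using (≤-refl; ≤-reflexive; ≤-trans; +-assoc; ≤-antisym; +-mono-≤; +-mono-≤-<; +-monoʳ-≤; +-cancelʳ-≤;
         +-cancelˡ-≡; +-cancelʳ-≡; +-identityʳ; <-irrefl; ≮⇒≥; m≤m+n; +-0-commutativeMonoid)
  renaming (_≟_ to _≟ℕ_)
open import Data.Bool using (Bool; true; false; not; _∧_; _∨_; if_then_else_)
open import Data.Bool.Properties using (not-involutive; ∧-identityʳ; ∧-zeroʳ; ∨-zeroʳ) renaming (_≟_ to _≟B_)
open import Data.Fin using (Fin; toℕ; _↑ˡ_; _↑ʳ_) renaming (zero to fzero; suc to fsuc)
open import Data.Fin.Properties using (toℕ-↑ˡ; toℕ-↑ʳ; toℕ<n; all?) renaming (_≟_ to _≟F_)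
open import Data.Fin.Permutation using (transpose)
import Data.Fin.Permutation.Components as Transposition
open import Data.Vec using (Vec; []; _∷_; lookup; tabulate)
open import Data.Vec.Properties using (lookup∘tabulate)
open import Data.List using (List; []; _∷_; cartesianProduct; allFin)
open import Data.List.Membership.Propositional using (_∈_)
open import Data.List.Membership.Propositional.Properties using (∈-cartesianProduct⁺; ∈-allFin)
open import Data.List.Relation.Unary.Any using (here; there)
open import Data.Product using (_×_; Σ; ∃; _,_; proj₁; proj₂)
open import Data.Sum using (_⊎_; inj₁; inj₂)
open import Relation.Nullary using (¬_; Dec; yes; no; does; contradiction)
open import Relation.Nullary.Decidable using (map′; _×-dec_; _→-dec_; dec-true)
open import Relation.Binary.PropositionalEquality
open import Algebra.Properties.CommutativeMonoid.Sum +-0-commutativeMonoid using (sum; sum-permute)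

ones : {n : ℕ} → (Fin n → Bool) → ℕ
ones {n} g = sumFin n (λ i → bit (g i))

ones-cong : ∀ {n} {f g : Fin n → Bool} → (∀ i → f i ≡ g i) → ones f ≡ ones g
ones-cong {zero}  f≗g = refl
ones-cong {suc n} f≗g = cong₂ _+_ (cong bit (f≗g fzero)) (ones-cong (λ i → f≗g (fsuc i)))

bit≤1 : ∀ b → bit b ≤ 1
bit≤1 false = z≤n
bit≤1 true  = ≤-refl

bit-injective : ∀ a b → bit a ≡ bit b → a ≡ b
bit-injective false false _ = refl
bit-injective true  true  _ = refl

bit-mono : ∀ a b → (b ≡ false → a ≡ false) → bit a ≤ bit b
bit-mono false b     _ = z≤n
bit-mono true  true  _ = ≤-refl
bit-mono true  false h with h refl
... | ()

ones-≤ : ∀ {n} (g : Fin n → Bool) → ones g ≤ n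
ones-≤ {zero}  g = z≤n
ones-≤ {suc n} g = +-mono-≤ (bit≤1 (g fzero)) (ones-≤ (λ i → g (fsuc i)))

ones-< : ∀ {n} (g : Fin n → Bool) (p : Fin n) → g p ≡ false → ones g < n
ones-< {suc n} g fzero    gp rewrite gp = s≤s (ones-≤ (λ i → g (fsuc i)))
ones-< {suc n} g (fsuc p) gp = +-mono-≤-< (bit≤1 (g fzero)) (ones-< (λ i → g (fsuc i)) p gp)

ones-full : ∀ {n} (g : Fin n → Bool) → (∀ i → g i ≡ true) → ones g ≡ n
ones-full {zero}  g all = refl
ones-full {suc n} g all rewrite all fzero = cong suc (ones-full (λ i → g (fsuc i)) (λ i → all (fsuc i)))

ones-empty : ∀ {n} (g : Fin n → Bool) → ones g ≡ 0 → ∀ i → g i ≡ false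
ones-empty {suc n} g none i with g fzero in g₀
ones-empty {suc n} g none fzero    | false = g₀
ones-empty {suc n} g none (fsuc i) | false = ones-empty (λ i → g (fsuc i)) none i

ones-nonempty : ∀ {n} (g : Fin n → Bool) → 0 < ones g → ∃ λ i → g i ≡ true
ones-nonempty {suc n} g some with g fzero in g₀
... | true  = fzero , g₀
... | false with ones-nonempty (λ i → g (fsuc i)) some
...   | i , gi = fsuc i , gi

ones-mono : ∀ {n} (f h : Fin n → Bool) → (∀ i → h i ≡ false → f i ≡ false) → ones f ≤ ones h
ones-mono {zero}  f h zeros = z≤n
ones-mono {suc n} f h zeros =
  +-mono-≤ (bit-mono _ _ (zeros fzero)) (ones-mono _ _ (λ i → zeros (fsuc i)))

+-equal-parts : ∀ {a b c d} → a ≤ b → c ≤ d → a + c ≡ b + d → a ≡ b × c ≡ d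
+-equal-parts {a} {b} {c} {d} a≤b c≤d sums =
  a≡b , +-cancelˡ-≡ b c d (subst (λ x → x + c ≡ b + d) a≡b sums)
  where
  b≤a : b ≤ a
  b≤a = +-cancelʳ-≤ c b a (≤-trans (+-monoʳ-≤ b c≤d) (≤-reflexive (sym sums)))
  a≡b : a ≡ b
  a≡b = ≤-antisym a≤b b≤a

ones-mono-≡ : ∀ {n} (f h : Fin n → Bool) → (∀ i → h i ≡ false → f i ≡ false) →
  ones f ≡ ones h → ∀ i → f i ≡ h i
ones-mono-≡ {suc n} f h zeros same i
  with +-equal-parts (bit-mono _ _ (zeros fzero)) (ones-mono _ _ (λ i → zeros (fsuc i))) same
ones-mono-≡ {suc n} f h zeros same fzero    | heads , _ = bit-injective _ _ heads
ones-mono-≡ {suc n} f h zeros same (fsuc i) | _ , tails =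
  ones-mono-≡ (λ i → f (fsuc i)) (λ i → h (fsuc i)) (λ i → zeros (fsuc i)) tails i

ones-++ : ∀ a b (g : Fin (a + b) → Bool) →
  ones g ≡ ones (λ i → g (i ↑ˡ b)) + ones (λ i → g (a ↑ʳ i))
ones-++ zero    b g = refl
ones-++ (suc a) b g = trans (cong (bit (g fzero) +_) (ones-++ a b (λ i → g (fsuc i))))
                            (sym (+-assoc (bit (g fzero)) _ _))

-- sumFin is the library's sum, which is invariant under permutations.
sumFin≡sum : ∀ n (f : Fin n → ℕ) → sumFin n f ≡ sum f
sumFin≡sum zero    f = refl
sumFin≡sum (suc n) f = cong (f fzero +_) (sumFin≡sum n (λ i → f (fsuc i)))

ones-transpose : ∀ {n} (f : Fin n → Bool) (p q : Fin n) →
  ones (λ x → f (Transposition.transpose p q x)) ≡ ones f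
ones-transpose {n} f p q = begin
  ones (λ x → f (Transposition.transpose p q x))
    ≡⟨ sumFin≡sum n _ ⟩
  sum (λ x → bit (f (Transposition.transpose p q x)))
    ≡⟨ sym (sum-permute (λ x → bit (f x)) (transpose p q)) ⟩
  sum (λ x → bit (f x))
    ≡⟨ sym (sumFin≡sum n _) ⟩
  ones f ∎
  where open ≡-Reasoning

_∈₂_,_ : ∀ {n} → Fin n → Fin n → Fin n → Bool
x ∈₂ p , q = does (x ≟F p) ∨ does (x ≟F q)

negateAt : ∀ {n} → Fin n → Fin n → (Fin n → Bool) → Fin n → Bool
negateAt p q f x = if x ∈₂ p , q then not (f x) else f x

negateAt-transpose : ∀ {n} (p q : Fin n) (f : Fin n → Bool) → f q ≡ not (f p) →
  ∀ x → negateAt p q f x ≡ f (Transposition.transpose p q x)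
negateAt-transpose p q f fq x with x ≟F p
... | yes refl = sym fq
... | no _ with x ≟F q
...   | yes refl = trans (cong not fq) (not-involutive (f p))
...   | no _     = refl

ones-negateAt : ∀ {n} (p q : Fin n) (f : Fin n → Bool) → f q ≡ not (f p) →
  ones (negateAt p q f) ≡ ones f
ones-negateAt p q f fq = trans (ones-cong (negateAt-transpose p q f fq)) (ones-transpose f p q)

opposite : ∀ {x y b : Bool} → x ≡ b → y ≡ not b → y ≡ not x
opposite refl refl = refl

opposite′ : ∀ {x y b : Bool} → x ≡ not b → y ≡ b → y ≡ not x
opposite′ {b = b} refl refl = sym (not-involutive b)

record Intercalate {n : ℕ} (M : Matrix n) (r₁ r₂ c₁ c₂ : Fin n) : Set where
  constructor intercalate
  field
    b   : Bool
    M₁₁ : M r₁ c₁ ≡ b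
    M₂₂ : M r₂ c₂ ≡ b
    M₁₂ : M r₁ c₂ ≡ not b
    M₂₁ : M r₂ c₁ ≡ not b

switch : ∀ {n} → Matrix n → (r₁ r₂ c₁ c₂ : Fin n) → Matrix n
switch M r₁ r₂ c₁ c₂ i j = if (i ∈₂ r₁ , r₂) ∧ (j ∈₂ c₁ , c₂) then not (M i j) else M i j

∈₂-pair : ∀ {n} {x p q : Fin n} → x ≡ p ⊎ x ≡ q → x ∈₂ p , q ≡ true
∈₂-pair {x = x} (inj₁ refl) rewrite dec-true (x ≟F x) refl = refl
∈₂-pair {x = x} {p} (inj₂ refl) rewrite dec-true (x ≟F x) refl = ∨-zeroʳ (does (x ≟F p))

pair-view : ∀ {n} (x p q : Fin n) → (x ≡ p ⊎ x ≡ q) ⊎ (x ∈₂ p , q ≡ false)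
pair-view x p q with x ≟F p
... | yes x≡p = inj₁ (inj₁ x≡p)
... | no _ with x ≟F q
...   | yes x≡q = inj₁ (inj₂ x≡q)
...   | no _    = inj₂ refl

module _ {n : ℕ} {M : Matrix n} {r₁ r₂ c₁ c₂ : Fin n} (I : Intercalate M r₁ r₂ c₁ c₂) where
  open Intercalate I

  switch-row : ∀ i → i ≡ r₁ ⊎ i ≡ r₂ → ∀ j → switch M r₁ r₂ c₁ c₂ i j ≡ negateAt c₁ c₂ (M i) j
  switch-row i i∈ j rewrite ∈₂-pair i∈ = refl

  switch-other-row : ∀ i → i ∈₂ r₁ , r₂ ≡ false → ∀ j → switch M r₁ r₂ c₁ c₂ i j ≡ M i j
  switch-other-row i i∉ j rewrite i∉ = refl

  switch-column : ∀ j → j ≡ c₁ ⊎ j ≡ c₂ → ∀ i → switch M r₁ r₂ c₁ c₂ i j ≡ negateAt r₁ r₂ (λ i → M i j) i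
  switch-column j j∈ i rewrite ∈₂-pair j∈ | ∧-identityʳ (i ∈₂ r₁ , r₂) = refl

  switch-other-column : ∀ j → j ∈₂ c₁ , c₂ ≡ false → ∀ i → switch M r₁ r₂ c₁ c₂ i j ≡ M i j
  switch-other-column j j∉ i rewrite j∉ | ∧-zeroʳ (i ∈₂ r₁ , r₂) = refl

  switch-rowSum : ∀ i → rowSum (switch M r₁ r₂ c₁ c₂) i ≡ rowSum M i
  switch-rowSum i with pair-view i r₁ r₂
  ... | inj₁ (inj₁ refl) = trans (ones-cong (switch-row i (inj₁ refl))) (ones-negateAt c₁ c₂ (M i) (opposite M₁₁ M₁₂))
  ... | inj₁ (inj₂ refl) = trans (ones-cong (switch-row i (inj₂ refl))) (ones-negateAt c₁ c₂ (M i) (opposite′ M₂₁ M₂₂))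
  ... | inj₂ i∉          = ones-cong (switch-other-row i i∉)

  switch-colSum : ∀ j → colSum (switch M r₁ r₂ c₁ c₂) j ≡ colSum M j
  switch-colSum j with pair-view j c₁ c₂
  ... | inj₁ (inj₁ refl) = trans (ones-cong (switch-column j (inj₁ refl))) (ones-negateAt r₁ r₂ _ (opposite M₁₁ M₂₁))
  ... | inj₁ (inj₂ refl) = trans (ones-cong (switch-column j (inj₂ refl))) (ones-negateAt r₁ r₂ _ (opposite′ M₁₂ M₂₂))
  ... | inj₂ j∉          = ones-cong (switch-other-column j j∉)

  switch-Λ : ∀ x → InΛ n x M → InΛ n x (switch M r₁ r₂ c₁ c₂)
  switch-Λ x (rows , cols) = (λ i → trans (switch-rowSum i) (rows i))
                           , (λ j → trans (switch-colSum j) (cols j))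

  switch-corner : switch M r₁ r₂ c₁ c₂ r₁ c₁ ≡ not (M r₁ c₁)
  switch-corner rewrite dec-true (r₁ ≟F r₁) refl | dec-true (c₁ ≟F c₁) refl = refl

  switch-contains : (S : CellSet n) →
    S r₁ c₁ ≡ false → S r₁ c₂ ≡ false → S r₂ c₁ ≡ false → S r₂ c₂ ≡ false →
    Contains (switch M r₁ r₂ c₁ c₂) M S
  switch-contains S s₁₁ s₁₂ s₂₁ s₂₂ i j s
    with i ≟F r₁ | i ≟F r₂ | j ≟F c₁ | j ≟F c₂
  ... | no _     | no _     | _        | _        = refl
  ... | yes _    | _        | no _     | no _     = refl
  ... | no _     | yes _    | no _     | no _     = refl
  ... | yes refl | _        | yes refl | _        = contradiction (trans (sym s₁₁) s) λ ()
  ... | yes refl | _        | no _     | yes refl = contradiction (trans (sym s₁₂) s) λ ()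
  ... | no _     | yes refl | yes refl | _        = contradiction (trans (sym s₂₁) s) λ ()
  ... | no _     | yes refl | no _     | yes refl = contradiction (trans (sym s₂₂) s) λ ()

intercalate-undetermined : ∀ {m} {M : Matrix (m + m)} {r₁ r₂ c₁ c₂} →
  Intercalate M r₁ r₂ c₁ c₂ → InΛ (m + m) m M → (S : CellSet (m + m)) →
  S r₁ c₁ ≡ false → S r₁ c₂ ≡ false → S r₂ c₁ ≡ false → S r₂ c₂ ≡ false →
  ¬ IsDefining m M S
intercalate-undetermined {m} {M} {r₁} {r₂} {c₁} {c₂} I M∈Λ S s₁₁ s₁₂ s₂₁ s₂₂ defines =
  never-fixed (M r₁ c₁) (trans (sym (switch-corner I))
    (defines (switch M r₁ r₂ c₁ c₂) (switch-Λ I m M∈Λ) (switch-contains I S s₁₁ s₁₂ s₂₁ s₂₂) r₁ c₁))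
  where
  never-fixed : ∀ x → ¬ not x ≡ x
  never-fixed false ()
  never-fixed true  ()

Exhaustible : Set → Set₁
Exhaustible A = ∀ {P : A → Set} → (∀ x → Dec (P x)) → Dec (∀ x → P x)

Bool-exhaustible : Exhaustible Bool
Bool-exhaustible P? = map′ (λ (pt , pf) → λ { true → pt ; false → pf })
                           (λ all → all true , all false)
                           (P? true ×-dec P? false)

Vec-exhaustible : ∀ {A} → Exhaustible A → ∀ n → Exhaustible (Vec A n)
Vec-exhaustible ex zero    P? = map′ (λ p → λ { [] → p }) (λ all → all []) (P? [])
Vec-exhaustible ex (suc n) P? =
  map′ (λ all → λ { (x ∷ xs) → all x xs }) (λ all x xs → all (x ∷ xs))
       (ex (λ x → Vec-exhaustible ex n (λ xs → P? (x ∷ xs))))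

-- Matrices as vectors of vectors, which can be exhausted.
toMatrix : ∀ {n} → Vec (Vec Bool n) n → Matrix n
toMatrix V i j = lookup (lookup V i) j

toMatrix-tabulate : ∀ {n} (N : Matrix n) i j → toMatrix (tabulate (λ i → tabulate (N i))) i j ≡ N i j
toMatrix-tabulate N i j rewrite lookup∘tabulate (λ i → tabulate (N i)) i = lookup∘tabulate (N i) j

Determines : (m : ℕ) → Matrix (m + m) → CellSet (m + m) → Matrix (m + m) → Set
Determines m M S N = InΛ (m + m) m N → Contains N M S → ∀ i j → N i j ≡ M i j

determines? : ∀ m M S N → Dec (Determines m M S N)
determines? m M S N = InΛ? →-dec contains? →-dec equal?
  where
  InΛ? : Dec (InΛ (m + m) m N)
  InΛ? = all? (λ i → rowSum N i ≟ℕ m) ×-dec all? (λ j → colSum N j ≟ℕ m)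
  contains? : Dec (Contains N M S)
  contains? = all? λ i → all? λ j → (S i j ≟B true) →-dec (N i j ≟B M i j)
  equal? : Dec (∀ i j → N i j ≡ M i j)
  equal? = all? λ i → all? λ j → N i j ≟B M i j

determines-resp : ∀ {m M S} {N N′ : Matrix (m + m)} → (∀ i j → N i j ≡ N′ i j) →
  Determines m M S N → Determines m M S N′
determines-resp N≗N′ det (rows , cols) contains i j =
  trans (sym (N≗N′ i j))
        (det ((λ i → trans (ones-cong (N≗N′ i)) (rows i)) ,
              (λ j → trans (ones-cong (λ i → N≗N′ i j)) (cols j)))
             (λ i j s → trans (N≗N′ i j) (contains i j s)) i j)

isDefining? : ∀ m M S → Dec (IsDefining m M S)
isDefining? m M S =
  map′ (λ all N → determines-resp (toMatrix-tabulate N) (all (tabulate (λ i → tabulate (N i)))))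
       (λ all V → all (toMatrix V))
       (Vec-exhaustible (Vec-exhaustible Bool-exhaustible (m + m)) (m + m)
                        (λ V → determines? m M S (toMatrix V)))

_⊆_ : ∀ {n} → CellSet n → CellSet n → Set
S ⊆ T = ∀ i j → S i j ≡ true → T i j ≡ true

⊆-false : ∀ {n} {S T : CellSet n} → S ⊆ T → ∀ {i j} → T i j ≡ false → S i j ≡ false
⊆-false {S = S} S⊆T {i} {j} Tij with S i j in Sij
... | false = refl
... | true  = contradiction (trans (sym Tij) (S⊆T i j Sij)) λ ()

without : ∀ {n} → CellSet n → Fin n → Fin n → CellSet n
without S a b i j = if does (i ≟F a) ∧ does (j ≟F b) then false else S i j

without-⊆ : ∀ {n} (S : CellSet n) a b → without S a b ⊆ S
without-⊆ S a b i j s with i ≟F a | j ≟F b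
... | yes _ | yes _ = contradiction s λ ()
... | yes _ | no _  = s
... | no _  | _     = s

without-self : ∀ {n} (S : CellSet n) a b → without S a b a b ≡ false
without-self S a b rewrite dec-true (a ≟F a) refl | dec-true (b ≟F b) refl = refl

⊆-without : ∀ {n} {K S : CellSet n} {a b} → K ⊆ S → K a b ≡ false → K ⊆ without S a b
⊆-without {a = a} {b} K⊆S Kab i j k with i ≟F a | j ≟F b
... | yes refl | yes refl = contradiction (trans (sym Kab) k) λ ()
... | yes _    | no _     = K⊆S i j k
... | no _     | _        = K⊆S i j k

Minimal : ∀ {n} → (CellSet n → Set) → CellSet n → Set
Minimal P K = P K × (∀ S′ → ProperSubset S′ K → ¬ P S′)

module MinimalSubsets {n : ℕ} (P : CellSet n → Set)
  (P-mono : ∀ {S T} → S ⊆ T → P S → P T) (P? : ∀ S → Dec (P S)) where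

  Irreducible : CellSet n → List (Fin n × Fin n) → Set
  Irreducible K cs = ∀ a b → (a , b) ∈ cs → K a b ≡ true → ¬ P (without K a b)

  shrink : ∀ S → P S → (cs : List (Fin n × Fin n)) → Σ (CellSet n) λ K → K ⊆ S × P K × Irreducible K cs
  shrink S PS [] = S , (λ _ _ s → s) , PS , λ _ _ ()
  shrink S PS ((a , b) ∷ cs) with P? (without S a b)
  ... | yes P-without with shrink (without S a b) P-without cs
  ...   | K , K⊆ , PK , irr = K , (λ i j k → without-⊆ S a b i j (K⊆ i j k)) , PK , irr′
    where
    irr′ : Irreducible K ((a , b) ∷ cs)
    irr′ _ _ (here refl) Kab = contradiction (trans (sym (without-self S a b)) (K⊆ a b Kab)) λ ()
    irr′ a′ b′ (there p) = irr a′ b′ p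
  shrink S PS ((a , b) ∷ cs) | no ¬P-without with shrink S PS cs
  ...   | K , K⊆ , PK , irr = K , K⊆ , PK , irr′
    where
    irr′ : Irreducible K ((a , b) ∷ cs)
    irr′ _ _ (here refl) Kab PK′ =
      ¬P-without (P-mono (⊆-without (λ i j k → K⊆ i j (without-⊆ K a b i j k)) (without-self K a b)) PK′)
    irr′ a′ b′ (there p) = irr a′ b′ p

  allCells : List (Fin n × Fin n)
  allCells = cartesianProduct (allFin n) (allFin n)

  minimal-subset : ∀ S → P S → Σ (CellSet n) λ K → K ⊆ S × Minimal P K
  minimal-subset S PS with shrink S PS allCells
  ... | K , K⊆S , PK , irr = K , K⊆S , PK , minimal
    where
    minimal : ∀ S′ → ProperSubset S′ K → ¬ P S′
    minimal S′ (S′⊆K , i , j , Kij , S′ij) PS′ =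
      irr i j (∈-cartesianProduct⁺ (∈-allFin i) (∈-allFin j)) Kij (P-mono (⊆-without S′⊆K S′ij) PS′)

  forced-cell : ∀ {K S} → K ⊆ S → P K → ∀ {a b} → ¬ P (without S a b) → K a b ≡ true
  forced-cell {K} K⊆S PK {a} {b} ¬P with K a b in Kab
  ... | true  = refl
  ... | false = contradiction (P-mono (⊆-without K⊆S Kab) PK) ¬P

defining-mono : ∀ {m M} {S T : CellSet (m + m)} → S ⊆ T → IsDefining m M S → IsDefining m M T
defining-mono S⊆T defines N N∈Λ contains = defines N N∈Λ (λ i j s → contains i j (S⊆T i j s))

below : ∀ a b (i : Fin (a + b)) → toℕ i < a → ∃ λ i′ → i′ ↑ˡ b ≡ i
below (suc a) b fzero    _         = fzero , refl
below (suc a) b (fsuc i) (s≤s i<a) with below a b i i<a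
... | i′ , refl = fsuc i′ , refl

above : ∀ a b (i : Fin (a + b)) → a ≤ toℕ i → ∃ λ i′ → a ↑ʳ i′ ≡ i
above zero    b i        _         = i , refl
above (suc a) b (fsuc i) (s≤s a≤i) with above a b i a≤i
... | i′ , refl = i′ , refl

↑ʳ-above : ∀ a {b} (i : Fin b) → a ≤ toℕ (a ↑ʳ i)
↑ʳ-above a i rewrite toℕ-↑ʳ a i = m≤m+n a (toℕ i)

module _ {a b : ℕ} (g : Fin (a + b) → Bool) (line : ones g ≡ a) where

  ones-front : ones (λ i → g (i ↑ˡ b)) + ones (λ i → g (a ↑ʳ i)) ≡ a
  ones-front = trans (sym (ones-++ a b g)) line

  line-rest-false : (∀ p → toℕ p < a → g p ≡ true) → ∀ q → a ≤ toℕ q → g q ≡ false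
  line-rest-false front q a≤q with above a b q a≤q
  ... | q′ , refl = ones-empty (λ i → g (a ↑ʳ i)) back-empty q′
    where
    front-full : ones (λ i → g (i ↑ˡ b)) ≡ a
    front-full = ones-full _ (λ i → front (i ↑ˡ b) (subst (_< a) (sym (toℕ-↑ˡ i b)) (toℕ<n i)))
    back-empty : ones (λ i → g (a ↑ʳ i)) ≡ 0
    back-empty = +-cancelˡ-≡ a _ 0
      (trans (trans (cong (_+ ones (λ i → g (a ↑ʳ i))) (sym front-full)) ones-front) (sym (+-identityʳ a)))

  line-rest-true : ∀ p → toℕ p < a → g p ≡ false → ∃ λ q → a ≤ toℕ q × g q ≡ true
  line-rest-true p p<a gp with below a b p p<a
  ... | p′ , refl with ones (λ i → g (a ↑ʳ i)) in back
  ...   | zero  = contradiction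
                    (trans (sym (+-identityʳ _)) (trans (cong (ones (λ i → g (i ↑ˡ b)) +_) (sym back)) ones-front))
                    (λ front≡a → <-irrefl front≡a (ones-< (λ i → g (i ↑ˡ b)) p′ gp))
  ...   | suc _ with ones-nonempty (λ i → g (a ↑ʳ i)) (subst (0 <_) (sym back) (s≤s z≤n))
  ...     | q′ , gq = a ↑ʳ q′ , ↑ʳ-above a q′ , gq

module _ {n : ℕ} (f g : Fin (suc n) → Bool) (same : ones f ≡ ones g)
  (zeros : ∀ i → g (fsuc i) ≡ false → f (fsuc i) ≡ false) where

  head-forced : g fzero ≡ true → f fzero ≡ true
  head-forced g₀ = bit-true heads g₀
    where
    heads : bit (g fzero) ≤ bit (f fzero)
    heads = +-cancelʳ-≤ (ones (λ i → f (fsuc i))) _ _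
      (≤-trans (+-monoʳ-≤ (bit (g fzero)) (ones-mono _ _ zeros)) (≤-reflexive (sym same)))
    bit-true : ∀ {a b} → bit a ≤ bit b → a ≡ true → b ≡ true
    bit-true {true} {true}  _  _ = refl
    bit-true {true} {false} () _

  tail-determined : f fzero ≡ g fzero → ∀ i → f (fsuc i) ≡ g (fsuc i)
  tail-determined heads = ones-mono-≡ _ _ zeros (+-cancelˡ-≡ (bit (g fzero)) _ _
    (subst (λ x → bit x + _ ≡ _) heads same))

head-determined : ∀ {n} (f g : Fin (suc n) → Bool) → ones f ≡ ones g →
  (∀ i → f (fsuc i) ≡ g (fsuc i)) → f fzero ≡ g fzero
head-determined f g same tails = bit-injective _ _ (+-cancelʳ-≡ _ _ _
  (trans (cong (bit (f fzero) +_) (sym (ones-cong tails))) same))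

module FirstLinesFull (k : ℕ) (M : Matrix (suc k + suc k)) (M∈Λ : InΛ (suc k + suc k) (suc k) M)
  (col₀ : ∀ i → toℕ i < suc k → M i fzero ≡ true)
  (row₀ : ∀ j → toℕ j < suc k → M fzero j ≡ true) where

  m : ℕ
  m = suc k

  0<m : 0 < m
  0<m = s≤s z≤n

  rows : ∀ i → rowSum M i ≡ m
  rows = proj₁ M∈Λ

  cols : ∀ j → colSum M j ≡ m
  cols = proj₂ M∈Λ

  col₀-rest : ∀ i → m ≤ toℕ i → M i fzero ≡ false
  col₀-rest = line-rest-false (λ i → M i fzero) (cols fzero) col₀

  row₀-rest : ∀ j → m ≤ toℕ j → M fzero j ≡ false
  row₀-rest = line-rest-false (M fzero) (rows fzero) row₀

  D₀ : CellSet (m + m)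
  D₀ fzero    fzero    = true
  D₀ fzero    (fsuc j) = false
  D₀ (fsuc i) fzero    = false
  D₀ (fsuc i) (fsuc j) = not (M (fsuc i) (fsuc j))

  D₀-row₀ : ∀ j → 1 ≤ toℕ j → D₀ fzero j ≡ false
  D₀-row₀ (fsuc j) _ = refl

  D₀-col₀ : ∀ i → 1 ≤ toℕ i → D₀ i fzero ≡ false
  D₀-col₀ (fsuc i) _ = refl

  D₀-ones : ∀ i j → 1 ≤ toℕ i → 1 ≤ toℕ j → M i j ≡ true → D₀ i j ≡ false
  D₀-ones (fsuc i) (fsuc j) _ _ Mij = cong not Mij

  D₀-defining : IsDefining m M D₀
  D₀-defining N (N-rows , N-cols) N⊇D₀ = agree
    where
    same-row : ∀ i → rowSum N i ≡ rowSum M i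
    same-row i = trans (N-rows i) (sym (rows i))
    same-col : ∀ j → colSum N j ≡ colSum M j
    same-col j = trans (N-cols j) (sym (cols j))
    inner-zeros : ∀ i j → M (fsuc i) (fsuc j) ≡ false → N (fsuc i) (fsuc j) ≡ false
    inner-zeros i j Mij = trans (N⊇D₀ (fsuc i) (fsuc j) (cong not Mij)) Mij
    N-col₀-front : ∀ i → toℕ i < m → N i fzero ≡ true
    N-col₀-front fzero    _   = trans (N⊇D₀ fzero fzero refl) (col₀ fzero 0<m)
    N-col₀-front (fsuc i) i<m =
      head-forced (N (fsuc i)) (M (fsuc i)) (same-row (fsuc i)) (inner-zeros i) (col₀ (fsuc i) i<m)
    N-col₀ : ∀ i → N i fzero ≡ M i fzero
    N-col₀ i with toℕ i <? m
    ... | yes i<m = trans (N-col₀-front i i<m) (sym (col₀ i i<m))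
    ... | no i≮m  = trans (line-rest-false (λ i → N i fzero) (N-cols fzero) N-col₀-front i (≮⇒≥ i≮m))
                          (sym (col₀-rest i (≮⇒≥ i≮m)))
    N-inner : ∀ i j → N (fsuc i) (fsuc j) ≡ M (fsuc i) (fsuc j)
    N-inner i = tail-determined (N (fsuc i)) (M (fsuc i)) (same-row (fsuc i)) (inner-zeros i) (N-col₀ (fsuc i))
    agree : ∀ i j → N i j ≡ M i j
    agree i        fzero    = N-col₀ i
    agree (fsuc i) (fsuc j) = N-inner i j
    agree fzero    (fsuc j) =
      head-determined (λ i → N i (fsuc j)) (λ i → M i (fsuc j)) (same-col (fsuc j)) (λ i → N-inner i j)

  absent : ∀ a b i j → D₀ i j ≡ false → without D₀ a b i j ≡ false
  absent a b i j = ⊆-false (without-⊆ D₀ a b) {i} {j}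

  R₃⇒1≤ : ∀ {i : Fin (m + m)} → InR₃ m i → 1 ≤ toℕ i
  R₃⇒1≤ = ≤-trans 0<m

  R₂₃⇒1≤ : ∀ {i : Fin (m + m)} → InR₂ m i ⊎ InR₃ m i → 1 ≤ toℕ i
  R₂₃⇒1≤ (inj₁ (1≤i , _)) = 1≤i
  R₂₃⇒1≤ (inj₂ m≤i)       = R₃⇒1≤ m≤i

  c₃ : Fin (m + m)
  c₃ = m ↑ʳ fzero {k}

  m≤c₃ : m ≤ toℕ c₃
  m≤c₃ = ↑ʳ-above m (fzero {k})

  -- The corner is needed: column c₃ has a one in some row i ≥ m+1; use the
  -- intercalate on rows 1, i and columns 1, c₃.
  corner-needed : ¬ IsDefining m M (without D₀ fzero fzero)
  corner-needed with line-rest-true (λ i → M i c₃) (cols c₃) fzero 0<m (row₀-rest c₃ m≤c₃)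
  ... | i , m≤i , Mic₃ =
    intercalate-undetermined
      (intercalate true (col₀ fzero 0<m) Mic₃ (row₀-rest c₃ m≤c₃) (col₀-rest i m≤i)) M∈Λ
      (without D₀ fzero fzero)
      (without-self D₀ fzero fzero) (absent fzero fzero fzero c₃ (D₀-row₀ c₃ (R₃⇒1≤ m≤c₃)))
      (absent fzero fzero i fzero (D₀-col₀ i (R₃⇒1≤ m≤i)))
      (absent fzero fzero i c₃ (D₀-ones i c₃ (R₃⇒1≤ m≤i) (R₃⇒1≤ m≤c₃) Mic₃))

  -- A zero at (a , b) with a ∈ R₂: column b has a one in some row i ≥ m+1;
  -- use rows a, i and columns b, 1.
  R₂-zero-needed : ∀ a b → InR₂ m a → 1 ≤ toℕ b → M a b ≡ false → ¬ IsDefining m M (without D₀ a b)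
  R₂-zero-needed a b (1≤a , a<m) 1≤b Mab
    with line-rest-true (λ i → M i b) (cols b) a a<m Mab
  ... | i , m≤i , Mib =
    intercalate-undetermined
      (intercalate false Mab (col₀-rest i m≤i) (col₀ a a<m) Mib) M∈Λ (without D₀ a b)
      (without-self D₀ a b) (absent a b a fzero (D₀-col₀ a 1≤a))
      (absent a b i b (D₀-ones i b (R₃⇒1≤ m≤i) 1≤b Mib)) (absent a b i fzero (D₀-col₀ i (R₃⇒1≤ m≤i)))

  -- A zero at (a , b) with a ∈ R₃, b ∈ R₂: row a has a one in some column j ≥ m+1;
  -- use rows a, 1 and columns b, j.
  R₃₂-zero-needed : ∀ a b → InR₃ m a → InR₂ m b → M a b ≡ false → ¬ IsDefining m M (without D₀ a b)
  R₃₂-zero-needed a b m≤a (1≤b , b<m) Mab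
    with line-rest-true (M a) (rows a) b b<m Mab
  ... | j , m≤j , Maj =
    intercalate-undetermined
      (intercalate false Mab (row₀-rest j m≤j) Maj (row₀ b b<m)) M∈Λ (without D₀ a b)
      (without-self D₀ a b) (absent a b a j (D₀-ones a j (R₃⇒1≤ m≤a) (R₃⇒1≤ m≤j) Maj))
      (absent a b fzero b (D₀-row₀ b 1≤b)) (absent a b fzero j (D₀-row₀ j (R₃⇒1≤ m≤j)))

  D₀-first-lines : ∀ i j → (InR₁ m i × (InR₂ m j ⊎ InR₃ m j)) ⊎ ((InR₂ m i ⊎ InR₃ m i) × InR₁ m j) →
    D₀ i j ≡ false
  D₀-first-lines fzero j (inj₁ (_ , j∈)) = D₀-row₀ j (R₂₃⇒1≤ j∈)
  D₀-first-lines i fzero (inj₂ (i∈ , _)) = D₀-col₀ i (R₂₃⇒1≤ i∈)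

  zero-needed : ∀ i j → (InR₂ m i × (InR₂ m j ⊎ InR₃ m j)) ⊎ (InR₃ m i × InR₂ m j) →
    M i j ≡ false → ¬ IsDefining m M (without D₀ i j)
  zero-needed i j (inj₁ (i∈ , j∈)) = R₂-zero-needed i j i∈ (R₂₃⇒1≤ j∈)
  zero-needed i j (inj₂ (i∈ , j∈)) = R₃₂-zero-needed i j i∈ j∈

lemma19 : (k : ℕ) → (M : Matrix (suc k + suc k)) → InΛ (suc k + suc k) (suc k) M →
    (∀ i → toℕ i < suc k → M i fzero ≡ true) →
    (∀ j → toℕ j < suc k → M fzero j ≡ true) →
    Σ (CellSet (suc k + suc k)) λ K →
      IsCritical (suc k) M K
      × (K fzero fzero ≡ true × M fzero fzero ≡ true)
      × (∀ i j → (InR₁ (suc k) i × (InR₂ (suc k) j ⊎ InR₃ (suc k) j))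
                 ⊎ ((InR₂ (suc k) i ⊎ InR₃ (suc k) i) × InR₁ (suc k) j) →
           K i j ≡ false)
      × (∀ i j → (InR₂ (suc k) i × (InR₂ (suc k) j ⊎ InR₃ (suc k) j))
                 ⊎ (InR₃ (suc k) i × InR₂ (suc k) j) →
           M i j ≡ false → K i j ≡ true)
      × (∀ i j → (InR₂ (suc k) i ⊎ InR₃ (suc k) i) → (InR₂ (suc k) j ⊎ InR₃ (suc k) j) →
           M i j ≡ true → K i j ≡ false)
lemma19 k M M∈Λ col₀ row₀ =
  K , K-critical
    , (forced-cell K⊆D₀ K-defining corner-needed , col₀ fzero 0<m)
    , (λ i j ij∈ → ⊆-false K⊆D₀ (D₀-first-lines i j ij∈))
    , (λ i j ij∈ Mij → forced-cell K⊆D₀ K-defining (zero-needed i j ij∈ Mij))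
    , (λ i j i∈ j∈ Mij → ⊆-false K⊆D₀ (D₀-ones i j (R₂₃⇒1≤ i∈) (R₂₃⇒1≤ j∈) Mij))
  where
  open FirstLinesFull k M M∈Λ col₀ row₀
  open MinimalSubsets (IsDefining m M) defining-mono (isDefining? m M)
  critical-subset : Σ (CellSet (m + m)) λ K → K ⊆ D₀ × IsCritical m M K
  critical-subset = minimal-subset D₀ D₀-defining
  K : CellSet (m + m)
  K = proj₁ critical-subset
  K⊆D₀ : K ⊆ D₀
  K⊆D₀ = proj₁ (proj₂ critical-subset)
  K-critical : IsCritical m M K
  K-critical = proj₂ (proj₂ critical-subset)
  K-defining : IsDefining m M K
  K-defining = proj₁ K-critical
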